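{- Let $\mathbb{C}$ and $\mathbb{A}$ be categories, $P\colon\mathbb{C}^{\mathrm{op}}\to\mathbb{A}$ and $S^{\mathrm{op}}\colon\mathbb{A}\to\mathbb{C}^{\mathrm{op}}$ functors with $S^{\mathrm{op}}\dashv P$, $F\colon\mathbb{C}\to\mathbb{C}$ and $M\colon\mathbb{A}\to\mathbb{A}$ endofunctors, and $\delta\colon MP\Rightarrow PF^{\mathrm{op}}$ a natural transformation. Assume $\mathbb{C}$ has finite limits, $M$ has an initial algebra $\beta\colon ML\xrightarrow{\cong}L$, and $F$ has a final coalgebra $\zeta\colon Z\xrightarrow{\cong}FZ$. Then for every $F$-coalgebra $c\colon X\to FX$ we have $\mathsf{FCSEq}_c\le\mathsf{TestEq}_c$ as subobjects of $X\times X$.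
   Context: For a coalgebra $c\colon X\to FX$: the interpretation $[\![\cdot]\!]_c\colon L\to PX$ is the unique arrow in $\mathbb{A}$ with $[\![\cdot]\!]_c\circ\beta=Pc\circ\delta_X\circ M[\![\cdot]\!]_c$ (here $Pc\colon PFX\to PX$); the theory map $\mathsf{th}_c\colon X\to SL$ in $\mathbb{C}$ is the transpose of $[\![\cdot]\!]_c$ under the adjunction $\mathbb{A}(L,PX)\cong\mathbb{C}(X,SL)$. The testing equivalence $\mathsf{TestEq}_c\rightarrowtail X\times X$ is the equalizer of $\mathsf{th}_c\circ\pi_1,\mathsf{th}_c\circ\pi_2\colon X\times X\to SL$ (the kernel pair of $\mathsf{th}_c$). With $\mathsf{beh}_c\colon X\to Z$ the unique coalgebra morphism from $c$ to $\zeta$, the FCS-equivalence $\mathsf{FCSEq}_c\rightarrowtail X\times X$ is the equalizer of $\mathsf{beh}_c\circ\pi_1,\mathsf{beh}_c\circ\pi_2$. -}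

module Defs where

open import Level using (Level; _⊔_) renaming (suc to lsuc)
open import Relation.Binary.PropositionalEquality using (_≡_)
open import Data.Product using (Σ; _,_)

record Category (o ℓ : Level) : Set (lsuc (o ⊔ ℓ)) where
  infixr 9 _∘_
  field
    Obj       : Set o
    Hom       : Obj → Obj → Set ℓ
    id        : ∀ {A} → Hom A A
    _∘_       : ∀ {A B C} → Hom B C → Hom A B → Hom A C
    identityˡ : ∀ {A B} {f : Hom A B} → id ∘ f ≡ f
    identityʳ : ∀ {A B} {f : Hom A B} → f ∘ id ≡ f
    assoc     : ∀ {A B C D} {f : Hom A B} {g : Hom B C} {h : Hom C D} →
                (h ∘ g) ∘ f ≡ h ∘ (g ∘ f)

open Category

op : ∀ {o ℓ} → Category o ℓ → Category o ℓ
op C = record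
  { Obj = Obj C
  ; Hom = λ A B → Hom C B A
  ; id = id C
  ; _∘_ = λ f g → _∘_ C g f
  ; identityˡ = identityʳ C
  ; identityʳ = identityˡ C
  ; assoc = Relation.Binary.PropositionalEquality.sym (assoc C)
  }
  where import Relation.Binary.PropositionalEquality

record Functor {o₁ ℓ₁ o₂ ℓ₂} (C : Category o₁ ℓ₁) (D : Category o₂ ℓ₂)
       : Set (o₁ ⊔ ℓ₁ ⊔ o₂ ⊔ ℓ₂) where
  field
    F₀       : Obj C → Obj D
    F₁       : ∀ {A B} → Hom C A B → Hom D (F₀ A) (F₀ B)
    identity : ∀ {A} → F₁ (id C {A}) ≡ id D
    homomorphism : ∀ {A B E} {f : Hom C A B} {g : Hom C B E} →
                   F₁ (_∘_ C g f) ≡ _∘_ D (F₁ g) (F₁ f)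

open Functor

Endofunctor : ∀ {o ℓ} → Category o ℓ → Set (o ⊔ ℓ)
Endofunctor C = Functor C C

_∘F_ : ∀ {o₁ ℓ₁ o₂ ℓ₂ o₃ ℓ₃} {C : Category o₁ ℓ₁} {D : Category o₂ ℓ₂}
         {E : Category o₃ ℓ₃} → Functor D E → Functor C D → Functor C E
_∘F_ {D = D} {E = E} G H = record
  { F₀ = λ x → F₀ G (F₀ H x)
  ; F₁ = λ f → F₁ G (F₁ H f)
  ; identity = trans (cong (F₁ G) (identity H)) (identity G)
  ; homomorphism = trans (cong (F₁ G) (homomorphism H)) (homomorphism G)
  }
  where open import Relation.Binary.PropositionalEquality using (trans; cong)

opF : ∀ {o₁ ℓ₁ o₂ ℓ₂} {C : Category o₁ ℓ₁} {D : Category o₂ ℓ₂} →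
      Functor C D → Functor (op C) (op D)
opF F = record
  { F₀ = F₀ F
  ; F₁ = F₁ F
  ; identity = identity F
  ; homomorphism = homomorphism F
  }

record NatTrans {o₁ ℓ₁ o₂ ℓ₂} {C : Category o₁ ℓ₁} {D : Category o₂ ℓ₂}
       (F G : Functor C D) : Set (o₁ ⊔ ℓ₁ ⊔ ℓ₂) where
  field
    η       : ∀ X → Hom D (F₀ F X) (F₀ G X)
    commute : ∀ {X Y} (f : Hom C X Y) →
              _∘_ D (η Y) (F₁ F f) ≡ _∘_ D (F₁ G f) (η X)

-- Adjunctions  L ⊣ R  (L : A → D, R : D → A), as a natural hom-bijection
--   D(L a, x) ≅ A(a, R x)

record Adjunction {o₁ ℓ₁ o₂ ℓ₂} {A : Category o₁ ℓ₁} {D : Category o₂ ℓ₂}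
       (L : Functor A D) (R : Functor D A) : Set (o₁ ⊔ ℓ₁ ⊔ o₂ ⊔ ℓ₂) where
  field
    φ : ∀ {a x} → Hom D (F₀ L a) x → Hom A a (F₀ R x)
    ψ : ∀ {a x} → Hom A a (F₀ R x) → Hom D (F₀ L a) x
    ψφ : ∀ {a x} (f : Hom D (F₀ L a) x) → ψ (φ f) ≡ f
    φψ : ∀ {a x} (g : Hom A a (F₀ R x)) → φ (ψ g) ≡ g
    natural : ∀ {a a′ x y} (h : Hom A a′ a) (f : Hom D (F₀ L a) x)
                (g : Hom D x y) →
              φ (_∘_ D g (_∘_ D f (F₁ L h))) ≡ _∘_ A (F₁ R g) (_∘_ A (φ f) h)

record Terminal {o ℓ} (C : Category o ℓ) : Set (o ⊔ ℓ) where
  field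
    ⊤      : Obj C
    !      : ∀ {A} → Hom C A ⊤
    !-unique : ∀ {A} (f : Hom C A ⊤) → f ≡ !

record Product {o ℓ} (C : Category o ℓ) (A B : Obj C) : Set (o ⊔ ℓ) where
  field
    A×B  : Obj C
    π₁   : Hom C A×B A
    π₂   : Hom C A×B B
    ⟨_,_⟩ : ∀ {X} → Hom C X A → Hom C X B → Hom C X A×B
    project₁ : ∀ {X} {f : Hom C X A} {g : Hom C X B} → _∘_ C π₁ ⟨ f , g ⟩ ≡ f
    project₂ : ∀ {X} {f : Hom C X A} {g : Hom C X B} → _∘_ C π₂ ⟨ f , g ⟩ ≡ g
    unique   : ∀ {X} {f : Hom C X A} {g : Hom C X B} (h : Hom C X A×B) →
               _∘_ C π₁ h ≡ f → _∘_ C π₂ h ≡ g → h ≡ ⟨ f , g ⟩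

record Equalizer {o ℓ} (C : Category o ℓ) {A B : Obj C} (f g : Hom C A B)
       : Set (o ⊔ ℓ) where
  field
    obj       : Obj C
    arr       : Hom C obj A
    equality  : _∘_ C f arr ≡ _∘_ C g arr
    equalize  : ∀ {X} (h : Hom C X A) → _∘_ C f h ≡ _∘_ C g h → Hom C X obj
    universal : ∀ {X} (h : Hom C X A) (eq : _∘_ C f h ≡ _∘_ C g h) →
                _∘_ C arr (equalize h eq) ≡ h
    unique    : ∀ {X} (h : Hom C X A) (eq : _∘_ C f h ≡ _∘_ C g h)
                  (i : Hom C X obj) → _∘_ C arr i ≡ h → i ≡ equalize h eq

record FiniteLimits {o ℓ} (C : Category o ℓ) : Set (o ⊔ ℓ) where
  field
    terminal  : Terminal C
    product   : ∀ A B → Product C A B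
    equalizer : ∀ {A B} (f g : Hom C A B) → Equalizer C f g

record InitialAlgebra {o ℓ} {A : Category o ℓ} (M : Endofunctor A)
       : Set (o ⊔ ℓ) where
  field
    L      : Obj A
    β      : Hom A (F₀ M L) L
    fold   : ∀ {B} → Hom A (F₀ M B) B → Hom A L B
    fold-hom : ∀ {B} (b : Hom A (F₀ M B) B) →
               _∘_ A (fold b) β ≡ _∘_ A b (F₁ M (fold b))
    fold-unique : ∀ {B} (b : Hom A (F₀ M B) B) (h : Hom A L B) →
                  _∘_ A h β ≡ _∘_ A b (F₁ M h) → h ≡ fold b
    β⁻¹    : Hom A L (F₀ M L)
    β-iso₁ : _∘_ A β β⁻¹ ≡ id A
    β-iso₂ : _∘_ A β⁻¹ β ≡ id A

record FinalCoalgebra {o ℓ} {C : Category o ℓ} (F : Endofunctor C)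
       : Set (o ⊔ ℓ) where
  field
    Z      : Obj C
    ζ      : Hom C Z (F₀ F Z)
    unfold : ∀ {X} → Hom C X (F₀ F X) → Hom C X Z
    unfold-hom : ∀ {X} (c : Hom C X (F₀ F X)) →
                 _∘_ C ζ (unfold c) ≡ _∘_ C (F₁ F (unfold c)) c
    unfold-unique : ∀ {X} (c : Hom C X (F₀ F X)) (h : Hom C X Z) →
                    _∘_ C ζ h ≡ _∘_ C (F₁ F h) c → h ≡ unfold c
    ζ⁻¹    : Hom C (F₀ F Z) Z
    ζ-iso₁ : _∘_ C ζ ζ⁻¹ ≡ id C
    ζ-iso₂ : _∘_ C ζ⁻¹ ζ ≡ id C

Monic : ∀ {o ℓ} (C : Category o ℓ) {A B : Obj C} → Hom C A B → Set (o ⊔ ℓ)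
Monic C {A} f = ∀ {X} (g h : Hom C X A) → _∘_ C f g ≡ _∘_ C f h → g ≡ h

record Subobject {o ℓ} (C : Category o ℓ) (X : Obj C) : Set (o ⊔ ℓ) where
  field
    dom   : Obj C
    arr   : Hom C dom X
    monic : Monic C arr

_≤ₛ_ : ∀ {o ℓ} {C : Category o ℓ} {X : Obj C} → Subobject C X → Subobject C X → Set ℓ
_≤ₛ_ {C = C} m n = Σ (Hom C (Subobject.dom m) (Subobject.dom n))
                     λ h → _∘_ C (Subobject.arr n) h ≡ Subobject.arr m

equalizer-subobject : ∀ {o ℓ} {C : Category o ℓ} {A B : Obj C} {f g : Hom C A B} →
                      Equalizer C f g → Subobject C A
equalizer-subobject {C = C} {f = f} {g = g} E = record
  { dom = obj ; arr = arr ; monic = mono }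
  where
    open Equalizer E
    open import Relation.Binary.PropositionalEquality using (sym; trans; cong)
    mono : Monic C arr
    mono {X} u v p = trans (unique h eq u refl′) (sym (unique h eq v (sym p)))
      where
        h  = _∘_ C arr u
        eq : _∘_ C f h ≡ _∘_ C g h
        eq = trans (sym (assoc C)) (trans (cong (λ k → _∘_ C k u) equality) (assoc C))
        refl′ : _∘_ C arr u ≡ h
        refl′ = Relation.Binary.PropositionalEquality.refl
        import Relation.Binary.PropositionalEquality

module Setting {o₁ ℓ₁ o₂ ℓ₂}
  (C : Category o₁ ℓ₁) (A : Category o₂ ℓ₂)
  (P : Functor (op C) A) (Sop : Functor A (op C))
  (adj : Adjunction Sop P)
  (F : Endofunctor C) (M : Endofunctor A)
  (δ : NatTrans (M ∘F P) (P ∘F opF F))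
  (lim : FiniteLimits C)
  (ini : InitialAlgebra M)
  (fin : FinalCoalgebra F)
  where

  open InitialAlgebra ini using (L; β; fold)
  open FinalCoalgebra fin using (Z; unfold)
  open FiniteLimits lim using (product; equalizer)

  module _ {X : Obj C} (c : Hom C X (F₀ F X)) where

    X×X : Obj C
    X×X = Product.A×B (product X X)

    p₁ p₂ : Hom C X×X X
    p₁ = Product.π₁ (product X X)
    p₂ = Product.π₂ (product X X)

    interp : Hom A L (F₀ P X)
    interp = fold (_∘_ A (F₁ P c) (NatTrans.η δ X))

    th : Hom C X (F₀ Sop L)
    th = Adjunction.ψ adj interp

    beh : Hom C X Z
    beh = unfold c

    TestEq : Subobject C X×X
    TestEq = equalizer-subobject (equalizer (_∘_ C th p₁) (_∘_ C th p₂))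

    FCSEq : Subobject C X×X
    FCSEq = equalizer-subobject (equalizer (_∘_ C beh p₁) (_∘_ C beh p₂))

module Submission where

-- The theory map of a coalgebra factors through its behaviour map:
--   th_c = th_ζ ∘ beh_c.
-- Indeed, for any coalgebra morphism h : (X, c) → (Y, d) the arrow P h ∘ [[·]]_d
-- satisfies the defining fold equation of [[·]]_c (naturality of δ plus
-- functoriality of P and M), so [[·]]_c = P h ∘ [[·]]_d by initiality of β;
-- transposing along S^op ⊣ P turns this into th_c = th_d ∘ h.
-- Since th_c factors through beh_c, any pair equalized by beh_c is equalized
-- by th_c, i.e. the kernel pair of beh_c is contained in that of th_c.

open import Defs
open import Relation.Binary.PropositionalEquality
open import Data.Product using (_,_)

module EqualizerFacts {o ℓ} (C : Category o ℓ) where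
  open Category C

  factor-equalizes : ∀ {A B B′ W} {f : Hom A B} {g : Hom A B′} (k : Hom B B′) →
                     g ≡ k ∘ f → (u v : Hom W A) → f ∘ u ≡ f ∘ v → g ∘ u ≡ g ∘ v
  factor-equalizes {f = f} {g} k g≡kf u v fu≡fv = begin
    g ∘ u         ≡⟨ cong (_∘ u) g≡kf ⟩
    (k ∘ f) ∘ u   ≡⟨ assoc ⟩
    k ∘ (f ∘ u)   ≡⟨ cong (k ∘_) fu≡fv ⟩
    k ∘ (f ∘ v)   ≡⟨ sym assoc ⟩
    (k ∘ f) ∘ v   ≡⟨ cong (_∘ v) (sym g≡kf) ⟩
    g ∘ v         ∎
    where open ≡-Reasoning

  equalizer-≤ : ∀ {A B B′} {f g : Hom A B} {f′ g′ : Hom A B′}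
                (E : Equalizer C f g) (E′ : Equalizer C f′ g′) →
                f′ ∘ Equalizer.arr E ≡ g′ ∘ Equalizer.arr E →
                equalizer-subobject E ≤ₛ equalizer-subobject E′
  equalizer-≤ E E′ eq =
    Equalizer.equalize E′ (Equalizer.arr E) eq ,
    Equalizer.universal E′ (Equalizer.arr E) eq

  equalizer-factor-≤ : ∀ {A B B′ W} {f : Hom A B} {g : Hom A B′} (k : Hom B B′) →
                       g ≡ k ∘ f → (u v : Hom W A) →
                       (E : Equalizer C (f ∘ u) (f ∘ v))
                       (E′ : Equalizer C (g ∘ u) (g ∘ v)) →
                       equalizer-subobject E ≤ₛ equalizer-subobject E′
  equalizer-factor-≤ {f = f} {g} k g≡kf u v E E′ = equalizer-≤ E E′ equalized
    where
    open ≡-Reasoning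
    e = Equalizer.arr E
    equalized : (g ∘ u) ∘ e ≡ (g ∘ v) ∘ e
    equalized = begin
      (g ∘ u) ∘ e  ≡⟨ assoc ⟩
      g ∘ (u ∘ e)  ≡⟨ factor-equalizes k g≡kf (u ∘ e) (v ∘ e)
                        (trans (sym assoc) (trans (Equalizer.equality E) assoc)) ⟩
      g ∘ (v ∘ e)  ≡⟨ sym assoc ⟩
      (g ∘ v) ∘ e  ∎

module AdjunctionFacts {o₁ ℓ₁ o₂ ℓ₂} {C : Category o₁ ℓ₁} {A : Category o₂ ℓ₂}
  {P : Functor (op C) A} {Sop : Functor A (op C)} (adj : Adjunction Sop P) where
  open Category C
  open Category A using () renaming (_∘_ to _∘A_; id to idA; identityʳ to identityʳA)
  open Functor
  open Adjunction adj

  ψ-natural : ∀ {a X Y} (h : Hom Y X) (t : Category.Hom A a (F₀ P X)) →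
              ψ (F₁ P h ∘A t) ≡ ψ t ∘ h
  ψ-natural h t = begin
    ψ (F₁ P h ∘A t)                             ≡⟨ cong (λ s → ψ (F₁ P h ∘A s)) (sym (φψ t)) ⟩
    ψ (F₁ P h ∘A φ (ψ t))                       ≡⟨ cong (λ s → ψ (F₁ P h ∘A s)) (sym identityʳA) ⟩
    ψ (F₁ P h ∘A (φ (ψ t) ∘A idA))              ≡⟨ cong ψ (sym (natural idA (ψ t) h)) ⟩
    ψ (φ ((F₁ Sop idA ∘ ψ t) ∘ h))              ≡⟨ ψφ _ ⟩
    (F₁ Sop idA ∘ ψ t) ∘ h                      ≡⟨ cong (λ s → (s ∘ ψ t) ∘ h) (identity Sop) ⟩
    (id ∘ ψ t) ∘ h                              ≡⟨ cong (_∘ h) identityˡ ⟩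
    ψ t ∘ h                                     ∎
    where open ≡-Reasoning

module InitialAlgebraFacts {o ℓ} {A : Category o ℓ} {M : Endofunctor A}
  (ini : InitialAlgebra M) where
  open Category A
  open Functor M
  open InitialAlgebra ini

  fold-fusion : ∀ {B B′} {b : Hom (F₀ B) B} {b′ : Hom (F₀ B′) B′} (k : Hom B B′) →
                k ∘ b ≡ b′ ∘ F₁ k → k ∘ fold b ≡ fold b′
  fold-fusion {b = b} {b′} k k-hom = fold-unique b′ (k ∘ fold b) (begin
    (k ∘ fold b) ∘ β              ≡⟨ assoc ⟩
    k ∘ (fold b ∘ β)              ≡⟨ cong (k ∘_) (fold-hom b) ⟩
    k ∘ (b ∘ F₁ (fold b))         ≡⟨ sym assoc ⟩
    (k ∘ b) ∘ F₁ (fold b)         ≡⟨ cong (_∘ F₁ (fold b)) k-hom ⟩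
    (b′ ∘ F₁ k) ∘ F₁ (fold b)     ≡⟨ assoc ⟩
    b′ ∘ (F₁ k ∘ F₁ (fold b))     ≡⟨ cong (b′ ∘_) (sym homomorphism) ⟩
    b′ ∘ F₁ (k ∘ fold b)          ∎)
    where open ≡-Reasoning

module CoalgebraicLogic {o₁ ℓ₁ o₂ ℓ₂}
  {C : Category o₁ ℓ₁} {A : Category o₂ ℓ₂}
  (P : Functor (op C) A) {Sop : Functor A (op C)} (adj : Adjunction Sop P)
  (F : Endofunctor C) (M : Endofunctor A)
  (δ : NatTrans (M ∘F P) (P ∘F opF F))
  (ini : InitialAlgebra M) where
  open Category C
  open Category A using () renaming (_∘_ to _∘A_; assoc to assocA)
  open Functor
  open NatTrans δ
  open InitialAlgebra ini using (fold)
  open Adjunction adj using (ψ)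
  open AdjunctionFacts adj using (ψ-natural)
  open InitialAlgebraFacts ini using (fold-fusion)

  -- The M-algebra  P c ∘ δ_X : M P X → P X  induced by a coalgebra c; its fold
  -- is the interpretation [[·]]_c and the transpose of that is th_c.
  algebra : ∀ {X} → Hom X (F₀ F X) → Category.Hom A (F₀ M (F₀ P X)) (F₀ P X)
  algebra {X} c = F₁ P c ∘A η X

  -- P sends a coalgebra morphism h : (X, c) → (Y, d) to an algebra morphism
  -- P h : (P Y, algebra d) → (P X, algebra c); this is where δ is natural.
  P-algebra-morphism : ∀ {X Y} {c : Hom X (F₀ F X)} {d : Hom Y (F₀ F Y)}
                       (h : Hom X Y) → d ∘ h ≡ F₁ F h ∘ c →
                       F₁ P h ∘A algebra d ≡ algebra c ∘A F₁ M (F₁ P h)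
  P-algebra-morphism {X} {Y} {c} {d} h h-hom = begin
    F₁ P h ∘A (F₁ P d ∘A η Y)         ≡⟨ sym assocA ⟩
    (F₁ P h ∘A F₁ P d) ∘A η Y         ≡⟨ cong (_∘A η Y) (sym (homomorphism P)) ⟩
    F₁ P (d ∘ h) ∘A η Y               ≡⟨ cong (λ k → F₁ P k ∘A η Y) h-hom ⟩
    F₁ P (F₁ F h ∘ c) ∘A η Y          ≡⟨ cong (_∘A η Y) (homomorphism P) ⟩
    (F₁ P c ∘A F₁ P (F₁ F h)) ∘A η Y  ≡⟨ assocA ⟩
    F₁ P c ∘A (F₁ P (F₁ F h) ∘A η Y)  ≡⟨ cong (F₁ P c ∘A_) (sym (commute h)) ⟩
    F₁ P c ∘A (η X ∘A F₁ M (F₁ P h))  ≡⟨ sym assocA ⟩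
    (F₁ P c ∘A η X) ∘A F₁ M (F₁ P h)  ∎
    where open ≡-Reasoning

  interp-natural : ∀ {X Y} {c : Hom X (F₀ F X)} {d : Hom Y (F₀ F Y)}
                   (h : Hom X Y) → d ∘ h ≡ F₁ F h ∘ c →
                   F₁ P h ∘A fold (algebra d) ≡ fold (algebra c)
  interp-natural h h-hom = fold-fusion (F₁ P h) (P-algebra-morphism h h-hom)

  th-natural : ∀ {X Y} {c : Hom X (F₀ F X)} {d : Hom Y (F₀ F Y)}
               (h : Hom X Y) → d ∘ h ≡ F₁ F h ∘ c →
               ψ (fold (algebra c)) ≡ ψ (fold (algebra d)) ∘ h
  th-natural {c = c} {d} h h-hom = begin
    ψ (fold (algebra c))                 ≡⟨ cong ψ (sym (interp-natural h h-hom)) ⟩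
    ψ (F₁ P h ∘A fold (algebra d))       ≡⟨ ψ-natural h (fold (algebra d)) ⟩
    ψ (fold (algebra d)) ∘ h             ∎
    where open ≡-Reasoning

-- FCS-equivalence is contained in testing equivalence: th_c = th_ζ ∘ beh_c,
-- so the kernel pair of beh_c lies below the kernel pair of th_c.
proposition5p5 : ∀ {o₁ ℓ₁ o₂ ℓ₂}
    (C : Category o₁ ℓ₁) (A : Category o₂ ℓ₂)
    (P : Functor (op C) A) (Sop : Functor A (op C))
    (adj : Adjunction Sop P)
    (F : Endofunctor C) (M : Endofunctor A)
    (δ : NatTrans (M ∘F P) (P ∘F opF F))
    (lim : FiniteLimits C)
    (ini : InitialAlgebra M)
    (fin : FinalCoalgebra F) →
    ∀ {X : Category.Obj C} (c : Category.Hom C X (Functor.F₀ F X)) →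
    Setting.FCSEq C A P Sop adj F M δ lim ini fin c
    ≤ₛ Setting.TestEq C A P Sop adj F M δ lim ini fin c
proposition5p5 C A P Sop adj F M δ lim ini fin c =
  equalizer-factor-≤ (th ζ) th-factors (p₁ c) (p₂ c)
    (equalizer (beh c ∘ p₁ c) (beh c ∘ p₂ c))
    (equalizer (th c ∘ p₁ c) (th c ∘ p₂ c))
  where
  open Category C using (_∘_)
  open Setting C A P Sop adj F M δ lim ini fin using (p₁; p₂; th; beh)
  open FiniteLimits lim using (equalizer)
  open FinalCoalgebra fin using (ζ; unfold-hom)
  open EqualizerFacts C using (equalizer-factor-≤)
  open CoalgebraicLogic P adj F M δ ini using (th-natural)

  th-factors : th c ≡ th ζ ∘ beh c
  th-factors = th-natural (beh c) (unfold-hom c)
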